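{- Let $k\ge1$ and let $\alpha=(\alpha_1,\ldots,\alpha_k)$ be nonnegative integers with $\alpha_1<\cdots<\alpha_k$. Let $L=\{1\le i\le k-1:\alpha_i+1<\alpha_{i+1}\}=\{\ell_1<\cdots<\ell_{t-1}\}$, $\ell_0=0$, $\ell_t=k$, $A_i=\{\ell_{i-1}+1,\ldots,\ell_i\}$ for $1\le i\le t$, and $T=S_{A_1}\times\cdots\times S_{A_t}\subset S_k$. Define $$\mathcal{G}_1(\alpha)=\{(\gamma,\sigma)\in\mathbb{N}_k\times S_k:\ \gamma\preceq\alpha\text{ and }\gamma_j-\sigma(j)=\alpha_j-j\text{ for all }j\},$$ $$\mathcal{G}_2(\alpha)=\{(\gamma,\sigma)\in\mathbb{N}_k\times T:\ \gamma_j=\alpha_{\sigma(j)}\text{ for all }j\}.$$ Then $\mathcal{G}_1(\alpha)=\mathcal{G}_2(\alpha)$.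
   Context: $\mathbb{N}$ denotes the nonnegative integers and $\mathbb{N}_k=\{(\gamma_1,\ldots,\gamma_k)\in\mathbb{N}^k:\gamma_i\ne\gamma_j\text{ for }i\ne j\}$. $S_k$ is the symmetric group on $\{1,\ldots,k\}$ and $S_{A}$ the symmetric group on a set $A$. For $\gamma,\beta\in\mathbb{N}_k$, $\gamma\preceq\beta$ means $\sum_{i=1}^k2^{ -\gamma_i}\ge\sum_{i=1}^k2^{ -\beta_i}$ (i.e., the set $\{\gamma_i\}$ precedes or equals $\{\beta_i\}$ in the lexicographic order on finite subsets of $\mathbb{N}$). -}

module Defs where

open import Data.Nat using (ℕ; zero; suc; _+_; _^_; _<_)
open import Data.Nat.Properties using (m^n≢0)
open import Data.Fin using (Fin; toℕ; fromℕ<)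
import Data.Fin as F
open import Data.Fin.Permutation using (Permutation′; _⟨$⟩ʳ_)
open import Data.Integer as ℤ using (ℤ; +_)
open import Data.Rational as ℚ using (ℚ; 0ℚ; _≤_)
open import Data.Product using (Σ; _×_)
open import Function using (Injective; _⇔_)
open import Relation.Binary.PropositionalEquality using (_≡_)

sumℚ : ∀ {k} → (Fin k → ℚ) → ℚ
sumℚ {zero} f = 0ℚ
sumℚ {suc k} f = f F.zero ℚ.+ sumℚ (λ i → f (F.suc i))

twoInv : ℕ → ℚ
twoInv n = (+ 1) ℚ./ (2 ^ n)
  where instance _ = m^n≢0 2 n

-- ℕ_k : k-tuples of pairwise distinct naturals (indices 0..k-1 stand for 1..k).
Distinct : ∀ {k} → (Fin k → ℕ) → Set
Distinct γ = Injective _≡_ _≡_ γ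

_⪯_ : ∀ {k} → (Fin k → ℕ) → (Fin k → ℕ) → Set
γ ⪯ β = sumℚ (λ i → twoInv (β i)) ≤ sumℚ (λ i → twoInv (γ i))

StrictlyIncreasing : ∀ {k} → (Fin k → ℕ) → Set
StrictlyIncreasing α = ∀ i j → i F.< j → α i < α j

-- 1-based position of a 0-based index.
pos : ∀ {k} → Fin k → ℕ
pos j = suc (toℕ j)

-- ℓ = pos i ∈ L  iff  ℓ ≤ k-1 and α_ℓ + 1 < α_{ℓ+1}.
InL : ∀ {k} → (Fin k → ℕ) → Fin k → Set
InL {k} α i = Σ (suc (toℕ i) < k) λ p → α i + 1 < α (fromℕ< p)

-- j and j' lie in the same block A_m: no ℓ ∈ L separates them,
-- i.e. for every ℓ ∈ L, (ℓ < j ⇔ ℓ < j').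
SameBlock : ∀ {k} → (Fin k → ℕ) → Fin k → Fin k → Set
SameBlock α j j' = ∀ i → InL α i → (pos i < pos j ⇔ pos i < pos j')

-- σ ∈ T = S_{A_1} × ⋯ × S_{A_t}: σ maps each block to itself.
InT : ∀ {k} → (Fin k → ℕ) → Permutation′ k → Set
InT α σ = ∀ j → SameBlock α j (σ ⟨$⟩ʳ j)

G₁ : ∀ {k} → (Fin k → ℕ) → (Fin k → ℕ) → Permutation′ k → Set
G₁ α γ σ = Distinct γ × γ ⪯ α ×
  (∀ j → (+ γ j) ℤ.- (+ pos (σ ⟨$⟩ʳ j)) ≡ (+ α j) ℤ.- (+ pos j))

G₂ : ∀ {k} → (Fin k → ℕ) → (Fin k → ℕ) → Permutation′ k → Set
G₂ α γ σ = Distinct γ × InT α σ × (∀ j → γ j ≡ α (σ ⟨$⟩ʳ j))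

-- Put offset j = α_j - j. As α is strictly increasing, offset is nondecreasing and jumps
-- exactly after the positions in L, so its level sets are the blocks A_i; hence σ ∈ T means
-- offset ∘ σ = offset, and then the equations γ_j - σ(j) = α_j - j of G₁ say γ_j = α_{σ(j)}.
-- Conversely, given G₁, suppose γ_j ≠ α_{σ(j)} with ρ = σ(j) minimal. The indices i with
-- offset i < offset ρ lie before ρ and are mapped into themselves by σ⁻¹, hence by σ.
-- It follows that α_ρ is not a value of γ while every smaller value of γ is a value of α,
-- so Σ 2^{-γ_i} < Σ 2^{-α_i} (compare the binary expansions of 2^M times both sides),
-- contradicting γ ⪯ α.
module Submission where

open import Defs
open import Data.Nat
  using (ℕ; zero; suc; _+_; _*_; _∸_; _^_; _≤_; _<_; _≥_; z≤n; s≤s; s≤s⁻¹; s<s; s<s⁻¹; NonZero)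
import Data.Nat.Properties as ℕ
open import Data.Fin using (Fin; toℕ; fromℕ<)
import Data.Fin as F
import Data.Fin.Properties as F
open import Data.Fin.Permutation as Perm using (Permutation′; _⟨$⟩ʳ_; _⟨$⟩ˡ_)
open import Data.Vec.Functional.Relation.Unary.Any using (Any)
open import Data.Product using (_,_)
open import Data.Sum using (inj₁; inj₂)
open import Data.Empty using (⊥-elim)
open import Function using (id; _∘_; _⇔_; mk⇔; Equivalence)
open import Relation.Binary.Core using (Rel)
open import Relation.Binary.Definitions using (Reflexive; Transitive; tri<; tri≈; tri>)
open import Relation.Binary.PropositionalEquality
open import Relation.Nullary using (¬_; Dec; yes; no)
open import Relation.Unary using (Pred; Decidable)
open import Data.Integer as ℤ using (ℤ; +_; _⊖_)
import Data.Integer.Properties as ℤ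
open import Data.Rational as ℚ using (toℚᵘ)
import Data.Rational.Properties as ℚ
open import Data.Rational.Unnormalised as ℚᵘ
  using (mkℚᵘ; *≡*; *≤*) renaming (_≃_ to _≃ᵘ_; _≤_ to _≤ᵘ_; _/_ to _/ᵘ_)
import Data.Rational.Unnormalised.Properties as ℚᵘ
import Algebra.Properties.CommutativeMonoid.Sum as Sum
open import Data.Nat.Tactic.RingSolver using (solve-∀)
import Data.Integer.Tactic.RingSolver as ℤ

open Sum ℕ.+-0-commutativeMonoid using (sum; sum-permute)

indicator : ∀ {p} {P : Set p} → Dec P → ℕ
indicator (yes _) = 1
indicator (no _)  = 0

indicator-mono : ∀ {p q} {P : Set p} {Q : Set q} (P? : Dec P) (Q? : Dec Q) →
                 (P → Q) → indicator P? ≤ indicator Q?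
indicator-mono (yes _) (yes _) _   = ℕ.≤-refl
indicator-mono (yes p) (no ¬q) P⇒Q = ⊥-elim (¬q (P⇒Q p))
indicator-mono (no _)  _       _   = z≤n

indicator≡1⇒ : ∀ {p} {P : Set p} (P? : Dec P) → indicator P? ≡ 1 → P
indicator≡1⇒ (yes p) _ = p

⇒indicator≡1 : ∀ {p} {P : Set p} (P? : Dec P) → P → indicator P? ≡ 1
⇒indicator≡1 (yes _) _ = refl
⇒indicator≡1 (no ¬p) p = ⊥-elim (¬p p)

⇒indicator≡0 : ∀ {p} {P : Set p} (P? : Dec P) → ¬ P → indicator P? ≡ 0
⇒indicator≡0 (yes p) ¬p = ⊥-elim (¬p p)
⇒indicator≡0 (no _)  _  = refl

sum-mono-≤ : ∀ {k} {f g : Fin k → ℕ} → (∀ i → f i ≤ g i) → sum f ≤ sum g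
sum-mono-≤ {zero}  f≤g = z≤n
sum-mono-≤ {suc k} f≤g = ℕ.+-mono-≤ (f≤g F.zero) (sum-mono-≤ (f≤g ∘ F.suc))

≤-sum : ∀ {k} (f : Fin k → ℕ) i → f i ≤ sum f
≤-sum f F.zero    = ℕ.m≤m+n _ _
≤-sum f (F.suc i) = ℕ.≤-trans (≤-sum (f ∘ F.suc) i) (ℕ.m≤n+m _ _)

sum-≡∧≤⇒≡ : ∀ {k} {f g : Fin k → ℕ} → (∀ i → f i ≤ g i) → sum f ≡ sum g → ∀ i → f i ≡ g i
sum-≡∧≤⇒≡ {suc k} {f} {g} f≤g Σf≡Σg = pointwise
  where
  head≡ : f F.zero ≡ g F.zero
  head≡ = ℕ.≤-antisym (f≤g F.zero) (ℕ.+-cancelʳ-≤ _ _ _ (begin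
    g F.zero + sum (f ∘ F.suc) ≤⟨ ℕ.+-monoʳ-≤ (g F.zero) (sum-mono-≤ (f≤g ∘ F.suc)) ⟩
    g F.zero + sum (g ∘ F.suc) ≡⟨ Σf≡Σg ⟨
    f F.zero + sum (f ∘ F.suc) ∎))
    where open ℕ.≤-Reasoning
  tail≡ : sum (f ∘ F.suc) ≡ sum (g ∘ F.suc)
  tail≡ = ℕ.+-cancelˡ-≡ (f F.zero) _ _ (trans Σf≡Σg (cong (_+ sum (g ∘ F.suc)) (sym head≡)))
  pointwise : ∀ i → f i ≡ g i
  pointwise F.zero    = head≡
  pointwise (F.suc i) = sum-≡∧≤⇒≡ (f≤g ∘ F.suc) tail≡ i

-- π⁻¹ maps P into P, and P is finite, so π⁻¹ maps P onto P.
closed⇒closed-inverse : ∀ {k p} (π : Permutation′ k) {P : Pred (Fin k) p} → Decidable P →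
  (∀ i → P i → P (π ⟨$⟩ˡ i)) → ∀ i → P i → P (π ⟨$⟩ʳ i)
closed⇒closed-inverse π {P} P? closed i Pi =
  indicator≡1⇒ (P? (π ⟨$⟩ʳ i)) (begin
    mark (π ⟨$⟩ʳ i)               ≡⟨ marks≡ (π ⟨$⟩ʳ i) ⟩
    mark (π ⟨$⟩ˡ (π ⟨$⟩ʳ i))      ≡⟨ cong mark (Perm.inverseˡ π) ⟩
    mark i                         ≡⟨ ⇒indicator≡1 (P? i) Pi ⟩
    1                               ∎)
  where
  open ≡-Reasoning
  mark : Fin _ → ℕ
  mark i = indicator (P? i)
  marks≡ : ∀ i → mark i ≡ mark (π ⟨$⟩ˡ i)
  marks≡ = sum-≡∧≤⇒≡ (λ i → indicator-mono (P? i) (P? _) (closed i))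
                      (sum-permute mark (Perm.flip π))

-- The number with binary digits c 0, c 1, …, c (m ∸ 1), most significant first.
bin : (ℕ → ℕ) → ℕ → ℕ
bin c zero    = 0
bin c (suc m) = 2 * bin c m + c m

bin-+ : ∀ (c e : ℕ → ℕ) m → bin (λ n → c n + e n) m ≡ bin c m + bin e m
bin-+ c e zero    = refl
bin-+ c e (suc m) rewrite bin-+ c e m = regroup (bin c m) (bin e m) (c m) (e m)
  where
  regroup : ∀ x y u w → 2 * (x + y) + (u + w) ≡ (2 * x + u) + (2 * y + w)
  regroup = solve-∀

bin-zeros : ∀ (c : ℕ → ℕ) m → (∀ n → n < m → c n ≡ 0) → bin c m ≡ 0
bin-zeros c zero    _    = refl
bin-zeros c (suc m) c≡0 rewrite bin-zeros c m (λ n n<m → c≡0 n (ℕ.m<n⇒m<1+n n<m))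
                               | c≡0 m ℕ.≤-refl = refl

bin-indicator : ∀ a m → a ≤ m → bin (λ n → indicator (a ℕ.≟ n)) (suc m) ≡ 2 ^ (m ∸ a)
bin-indicator a m a≤m with ℕ.m≤n⇒m<n∨m≡n a≤m
... | inj₂ refl = begin
  2 * bin δₐ a + δₐ a  ≡⟨ cong (λ x → 2 * x + δₐ a) (bin-zeros δₐ a below) ⟩
  δₐ a                 ≡⟨ ⇒indicator≡1 (a ℕ.≟ a) refl ⟩
  1                    ≡⟨ cong (2 ^_) (ℕ.n∸n≡0 a) ⟨
  2 ^ (a ∸ a)          ∎
  where
  open ≡-Reasoning
  δₐ : ℕ → ℕ
  δₐ n = indicator (a ℕ.≟ n)
  below : ∀ n → n < a → δₐ n ≡ 0
  below n n<a = ⇒indicator≡0 (a ℕ.≟ n) (λ a≡n → ℕ.<-irrefl (sym a≡n) n<a)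
bin-indicator a (suc m) _ | inj₁ (s≤s a≤m)
  rewrite bin-indicator a m a≤m
        | ⇒indicator≡0 (a ℕ.≟ suc m) (λ a≡1+m → ℕ.<-irrefl a≡1+m (s≤s a≤m))
        | ℕ.+-∸-assoc 1 a≤m = ℕ.+-identityʳ _

count : ∀ {k} → (Fin k → ℕ) → ℕ → ℕ
count f n = sum (λ i → indicator (f i ℕ.≟ n))

sum-2^∸≡bin-count : ∀ {k} M (f : Fin k → ℕ) → (∀ i → f i ≤ M) →
                    sum (λ i → 2 ^ (M ∸ f i)) ≡ bin (count f) (suc M)
sum-2^∸≡bin-count {zero}  M f _   = sym (bin-zeros _ (suc M) (λ _ _ → refl))
sum-2^∸≡bin-count {suc k} M f f≤M = begin
  2 ^ (M ∸ f F.zero) + sum (λ i → 2 ^ (M ∸ f (F.suc i)))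
    ≡⟨ cong₂ _+_ (sym (bin-indicator (f F.zero) M (f≤M F.zero)))
                 (sum-2^∸≡bin-count M (f ∘ F.suc) (f≤M ∘ F.suc)) ⟩
  bin (λ n → indicator (f F.zero ℕ.≟ n)) (suc M) + bin (count (f ∘ F.suc)) (suc M)
    ≡⟨ bin-+ _ (count (f ∘ F.suc)) (suc M) ⟨
  bin (count f) (suc M) ∎
  where open ≡-Reasoning

Any⇒count≥1 : ∀ {k} (f : Fin k → ℕ) {n} → Any (_≡ n) f → 1 ≤ count f n
Any⇒count≥1 f {n} (F.zero , f₀≡n) =
  ℕ.≤-trans (ℕ.≤-reflexive (sym (⇒indicator≡1 (f F.zero ℕ.≟ n) f₀≡n))) (ℕ.m≤m+n _ _)
Any⇒count≥1 f (F.suc i , fᵢ≡n) = ℕ.≤-trans (Any⇒count≥1 (f ∘ F.suc) (i , fᵢ≡n)) (ℕ.m≤n+m _ _)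

count≥1⇒Any : ∀ {k} (f : Fin k → ℕ) {n} → 1 ≤ count f n → Any (_≡ n) f
count≥1⇒Any {suc k} f {n} count≥1 with f F.zero ℕ.≟ n
... | yes f₀≡n = F.zero , f₀≡n
... | no _ with count≥1⇒Any (f ∘ F.suc) count≥1
...   | i , fᵢ≡n = F.suc i , fᵢ≡n

¬Any⇒count≡0 : ∀ {k} (f : Fin k → ℕ) {n} → ¬ Any (_≡ n) f → count f n ≡ 0
¬Any⇒count≡0 {zero}  f      _    = refl
¬Any⇒count≡0 {suc k} f {n} ¬any
  rewrite ⇒indicator≡0 (f F.zero ℕ.≟ n) (λ f₀≡n → ¬any (F.zero , f₀≡n)) =
  ¬Any⇒count≡0 (f ∘ F.suc) (λ (i , fᵢ≡n) → ¬any (F.suc i , fᵢ≡n))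

Distinct⇒count≤1 : ∀ {k} (f : Fin k → ℕ) → Distinct f → ∀ n → count f n ≤ 1
Distinct⇒count≤1 {zero}  f _        n = z≤n
Distinct⇒count≤1 {suc k} f distinct n with f F.zero ℕ.≟ n
... | yes f₀≡n
  rewrite ¬Any⇒count≡0 (f ∘ F.suc) (λ (i , fᵢ≡n) → F.0≢1+n (distinct (trans f₀≡n (sym fᵢ≡n)))) =
  ℕ.≤-refl
... | no _ = Distinct⇒count≤1 (f ∘ F.suc) (F.suc-injective ∘ distinct) n

bin-mono-≤ : ∀ (c e : ℕ → ℕ) m → (∀ n → n < m → c n ≤ e n) → bin c m ≤ bin e m
bin-mono-≤ c e zero    _   = z≤n
bin-mono-≤ c e (suc m) c≤e =
  ℕ.+-mono-≤ (ℕ.*-monoʳ-≤ 2 (bin-mono-≤ c e m (λ n n<m → c≤e n (ℕ.m<n⇒m<1+n n<m)))) (c≤e m ℕ.≤-refl)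

-- The digits of c must be bits: otherwise the digits after position v could make up for
-- the loss at v.
bin-lex-< : ∀ (c e : ℕ → ℕ) v → (∀ n → c n ≤ 1) → (∀ n → n < v → c n ≤ e n) → c v < e v →
            ∀ m → v < m → bin c m < bin e m
bin-lex-< c e v bits c≤e cᵥ<eᵥ (suc m) (s≤s v≤m) with ℕ.m≤n⇒m<n∨m≡n v≤m
... | inj₂ refl = ℕ.+-mono-≤-< (ℕ.*-monoʳ-≤ 2 (bin-mono-≤ c e v c≤e)) cᵥ<eᵥ
... | inj₁ v<m = begin-strict
  2 * bin c m + c m   ≤⟨ ℕ.+-monoʳ-≤ (2 * bin c m) (bits m) ⟩
  2 * bin c m + 1     <⟨ ℕ.+-monoʳ-< (2 * bin c m) (ℕ.n<1+n 1) ⟩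
  2 * bin c m + 2     ≡⟨ trans (ℕ.+-comm (2 * bin c m) 2) (sym (ℕ.*-suc 2 (bin c m))) ⟩
  2 * suc (bin c m)   ≤⟨ ℕ.*-monoʳ-≤ 2 (bin-lex-< c e v bits c≤e cᵥ<eᵥ m v<m) ⟩
  2 * bin e m         ≤⟨ ℕ.m≤m+n (2 * bin e m) (e m) ⟩
  2 * bin e m + e m   ∎
  where open ℕ.≤-Reasoning

-- Witness that the value set of α comes strictly before that of γ in the lexicographic order.
record LexBelowAt {k} (α γ : Fin k → ℕ) (v : ℕ) : Set where
  field
    value     : Any (_≡ v) α
    not-value : ¬ Any (_≡ v) γ
    below     : ∀ j → γ j < v → Any (_≡ γ j) α

sum-2^∸-lex-< : ∀ {k} M {α γ : Fin k → ℕ} {v} → Distinct γ → (∀ i → γ i ≤ M) → (∀ i → α i ≤ M) →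
                LexBelowAt α γ v → sum (λ i → 2 ^ (M ∸ γ i)) < sum (λ i → 2 ^ (M ∸ α i))
sum-2^∸-lex-< M {α} {γ} {v} distinct γ≤M α≤M lex
  rewrite sum-2^∸≡bin-count M γ γ≤M | sum-2^∸≡bin-count M α α≤M =
  bin-lex-< (count γ) (count α) v (Distinct⇒count≤1 γ distinct) counts-below counts-at
            (suc M) (s≤s v≤M)
  where
  open LexBelowAt lex
  v≤M : v ≤ M
  v≤M = let (i , αᵢ≡v) = value in subst (_≤ M) αᵢ≡v (α≤M i)
  counts-at : count γ v < count α v
  counts-at = subst (_< count α v) (sym (¬Any⇒count≡0 γ not-value)) (Any⇒count≥1 α value)
  bit-≤ : ∀ {x y} → x ≤ 1 → (1 ≤ x → 1 ≤ y) → x ≤ y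
  bit-≤ {zero}  _         _ = z≤n
  bit-≤ {suc _} (s≤s z≤n) h = h (s≤s z≤n)
  counts-below : ∀ n → n < v → count γ n ≤ count α n
  counts-below n n<v = bit-≤ (Distinct⇒count≤1 γ distinct n) λ count≥1 →
    let (j , γⱼ≡n) = count≥1⇒Any γ count≥1
        (i , αᵢ≡γⱼ) = below j (subst (_< v) (sym γⱼ≡n) n<v)
    in Any⇒count≥1 α (i , trans αᵢ≡γⱼ γⱼ≡n)

toℚᵘ-/ : ∀ i n .{{_ : NonZero n}} → toℚᵘ (i ℚ./ n) ≃ᵘ i /ᵘ n
toℚᵘ-/ i (suc n) = ℚ.toℚᵘ-fromℚᵘ (mkℚᵘ i n)

/ᵘ-+-/ᵘ : ∀ i j d .{{_ : NonZero d}} → (i /ᵘ d) ℚᵘ.+ (j /ᵘ d) ≃ᵘ (i ℤ.+ j) /ᵘ d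
/ᵘ-+-/ᵘ i j (suc d) = *≡* (begin
  (i ℤ.* D ℤ.+ j ℤ.* D) ℤ.* D  ≡⟨ factor i j D ⟩
  (i ℤ.+ j) ℤ.* (D ℤ.* D)      ≡⟨ cong ((i ℤ.+ j) ℤ.*_) (ℤ.pos-* (suc d) (suc d)) ⟨
  (i ℤ.+ j) ℤ.* + (suc d * suc d) ∎)
  where
  open ≡-Reasoning
  D : ℤ
  D = + suc d
  factor : ∀ i j D → (i ℤ.* D ℤ.+ j ℤ.* D) ℤ.* D ≡ (i ℤ.+ j) ℤ.* (D ℤ.* D)
  factor = ℤ.solve-∀

/ᵘ-cancel-≤ : ∀ m n d .{{_ : NonZero d}} → (+ m) /ᵘ d ≤ᵘ (+ n) /ᵘ d → m ≤ n
/ᵘ-cancel-≤ m n (suc d) (*≤* m*d≤n*d) =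
  ℤ.drop‿+≤+ (ℤ.*-cancelʳ-≤-pos (+ m) (+ n) (+ suc d) m*d≤n*d)

sumℚ-permute : ∀ {k} {f g : Fin k → ℚ.ℚ} (π : Permutation′ k) → (∀ i → f (π ⟨$⟩ʳ i) ≡ g i) →
               sumℚ f ≡ sumℚ g
sumℚ-permute {f = f} {g} π f∘π≗g = begin
  sumℚ f                        ≡⟨ sumℚ≡sum f ⟩
  sumᵠ f                        ≡⟨ sumᵠ-permute f π ⟩
  sumᵠ (λ i → f (π ⟨$⟩ʳ i))     ≡⟨ sumᵠ-cong-≗ f∘π≗g ⟩
  sumᵠ g                        ≡⟨ sumℚ≡sum g ⟨
  sumℚ g                        ∎
  where
  open ≡-Reasoning
  open Sum ℚ.+-0-commutativeMonoid using ()
    renaming (sum to sumᵠ; sum-permute to sumᵠ-permute; sum-cong-≗ to sumᵠ-cong-≗)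
  sumℚ≡sum : ∀ {k} (f : Fin k → ℚ.ℚ) → sumℚ f ≡ sumᵠ f
  sumℚ≡sum {zero}  f = refl
  sumℚ≡sum {suc k} f = cong (f F.zero ℚ.+_) (sumℚ≡sum (f ∘ F.suc))

module _ (M : ℕ) where
  private instance
    2^M≢0 : NonZero (2 ^ M)
    2^M≢0 = ℕ.m^n≢0 2 M

  toℚᵘ-twoInv : ∀ {n} → n ≤ M → toℚᵘ (twoInv n) ≃ᵘ (+ 2 ^ (M ∸ n)) /ᵘ 2 ^ M
  toℚᵘ-twoInv {n} n≤M = begin-equality
    toℚᵘ (twoInv n)                                  ≃⟨ toℚᵘ-/ (+ 1) (2 ^ n) ⟩
    (+ 1) /ᵘ 2 ^ n                                   ≃⟨ ℚᵘ.*-cancelˡ-/ (2 ^ (M ∸ n)) ⟨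
    (+ 2 ^ (M ∸ n) ℤ.* + 1) /ᵘ (2 ^ (M ∸ n) * 2 ^ n) ≡⟨ ℚᵘ./-cong (ℤ.*-identityʳ _) 2^M∸n*2^n≡2^M ⟩
    (+ 2 ^ (M ∸ n)) /ᵘ 2 ^ M                         ∎
    where
    open ℚᵘ.≤-Reasoning
    instance
      2^n≢0 : NonZero (2 ^ n)
      2^n≢0 = ℕ.m^n≢0 2 n
      2^M∸n≢0 : NonZero (2 ^ (M ∸ n))
      2^M∸n≢0 = ℕ.m^n≢0 2 (M ∸ n)
      2^M∸n*2^n≢0 : NonZero (2 ^ (M ∸ n) * 2 ^ n)
      2^M∸n*2^n≢0 = ℕ.m*n≢0 (2 ^ (M ∸ n)) (2 ^ n)
    2^M∸n*2^n≡2^M : 2 ^ (M ∸ n) * 2 ^ n ≡ 2 ^ M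
    2^M∸n*2^n≡2^M = trans (sym (ℕ.^-distribˡ-+-* 2 (M ∸ n) n)) (cong (2 ^_) (ℕ.m∸n+n≡m n≤M))

  toℚᵘ-sumℚ-twoInv : ∀ {k} (f : Fin k → ℕ) → (∀ i → f i ≤ M) →
    toℚᵘ (sumℚ (λ i → twoInv (f i))) ≃ᵘ (+ sum (λ i → 2 ^ (M ∸ f i))) /ᵘ 2 ^ M
  toℚᵘ-sumℚ-twoInv {zero}  f _   =
    *≡* (sym (trans (ℤ.*-identityʳ _) (ℚᵘ.↥[n/d]≡n (+ 0) (2 ^ M))))
  toℚᵘ-sumℚ-twoInv {suc k} f f≤M = begin-equality
    toℚᵘ (twoInv (f F.zero) ℚ.+ sumℚ (λ i → twoInv (f (F.suc i))))
      ≃⟨ ℚ.toℚᵘ-homo-+ (twoInv (f F.zero)) _ ⟩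
    toℚᵘ (twoInv (f F.zero)) ℚᵘ.+ toℚᵘ (sumℚ (λ i → twoInv (f (F.suc i))))
      ≃⟨ ℚᵘ.+-cong (toℚᵘ-twoInv (f≤M F.zero)) (toℚᵘ-sumℚ-twoInv (f ∘ F.suc) (f≤M ∘ F.suc)) ⟩
    (+ 2 ^ (M ∸ f F.zero)) /ᵘ 2 ^ M ℚᵘ.+ (+ sum (λ i → 2 ^ (M ∸ f (F.suc i)))) /ᵘ 2 ^ M
      ≃⟨ /ᵘ-+-/ᵘ _ _ (2 ^ M) ⟩
    (+ 2 ^ (M ∸ f F.zero) ℤ.+ + sum (λ i → 2 ^ (M ∸ f (F.suc i)))) /ᵘ 2 ^ M
      ≡⟨ ℚᵘ./-cong (ℤ.pos-+ (2 ^ (M ∸ f F.zero)) (sum (λ i → 2 ^ (M ∸ f (F.suc i))))) refl ⟨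
    (+ sum (λ i → 2 ^ (M ∸ f i))) /ᵘ 2 ^ M ∎
    where open ℚᵘ.≤-Reasoning

  ⪯⇒sum-2^∸-≤ : ∀ {k} {γ α : Fin k → ℕ} → (∀ i → γ i ≤ M) → (∀ i → α i ≤ M) →
                γ ⪯ α → sum (λ i → 2 ^ (M ∸ α i)) ≤ sum (λ i → 2 ^ (M ∸ γ i))
  ⪯⇒sum-2^∸-≤ {γ = γ} {α} γ≤M α≤M γ⪯α = /ᵘ-cancel-≤ _ _ (2 ^ M)
    (ℚᵘ.≤-respʳ-≃ (toℚᵘ-sumℚ-twoInv γ γ≤M)
      (ℚᵘ.≤-respˡ-≃ (toℚᵘ-sumℚ-twoInv α α≤M) (ℚ.toℚᵘ-mono-≤ γ⪯α)))

⪯⇒¬LexBelowAt : ∀ {k} {α γ : Fin k → ℕ} {v} → Distinct γ → γ ⪯ α → ¬ LexBelowAt α γ v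
⪯⇒¬LexBelowAt {α = α} {γ} distinct γ⪯α lex =
  ℕ.<⇒≱ (sum-2^∸-lex-< M distinct γ≤M α≤M lex) (⪯⇒sum-2^∸-≤ M γ≤M α≤M γ⪯α)
  where
  M : ℕ
  M = sum α + sum γ
  α≤M : ∀ i → α i ≤ M
  α≤M i = ℕ.≤-trans (≤-sum α i) (ℕ.m≤m+n _ _)
  γ≤M : ∀ i → γ i ≤ M
  γ≤M i = ℕ.≤-trans (≤-sum γ i) (ℕ.m≤n+m _ _)

Fin-chain : ∀ {k r} (R : Rel (Fin k) r) → Reflexive R → Transitive R → ∀ {a b} → toℕ a ≤ toℕ b →
  (∀ {m m⁺} → toℕ a ≤ toℕ m → toℕ m⁺ ≡ suc (toℕ m) → toℕ m⁺ ≤ toℕ b → R m m⁺) → R a b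
Fin-chain {k} R R-refl R-trans {a} {b} a≤b step = go (toℕ b ∸ toℕ a) b (sym (ℕ.m∸n+n≡m a≤b)) step
  where
  go : ∀ d b → toℕ b ≡ d + toℕ a →
       (∀ {m m⁺} → toℕ a ≤ toℕ m → toℕ m⁺ ≡ suc (toℕ m) → toℕ m⁺ ≤ toℕ b → R m m⁺) → R a b
  go zero    b b≡a _    = subst (R a) (F.toℕ-injective (sym b≡a)) R-refl
  go (suc d) b b≡d+1+a step = R-trans (go d b⁻ b⁻≡d+a step⁻) (step a≤b⁻ b≡1+b⁻ ℕ.≤-refl)
    where
    d+a<k : d + toℕ a < k
    d+a<k = ℕ.≤-trans (ℕ.≤-reflexive (sym b≡d+1+a)) (ℕ.<⇒≤ (F.toℕ<n b))
    b⁻ : Fin k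
    b⁻ = fromℕ< d+a<k
    b⁻≡d+a : toℕ b⁻ ≡ d + toℕ a
    b⁻≡d+a = F.toℕ-fromℕ< d+a<k
    b≡1+b⁻ : toℕ b ≡ suc (toℕ b⁻)
    b≡1+b⁻ = trans b≡d+1+a (cong suc (sym b⁻≡d+a))
    b⁻<b : toℕ b⁻ < toℕ b
    b⁻<b = ℕ.≤-reflexive (sym b≡1+b⁻)
    a≤b⁻ : toℕ a ≤ toℕ b⁻
    a≤b⁻ = subst (toℕ a ≤_) (sym b⁻≡d+a) (ℕ.m≤n+m (toℕ a) d)
    step⁻ : ∀ {m m⁺} → toℕ a ≤ toℕ m → toℕ m⁺ ≡ suc (toℕ m) → toℕ m⁺ ≤ toℕ b⁻ → R m m⁺
    step⁻ a≤m m⁺≡1+m m⁺≤b⁻ = step a≤m m⁺≡1+m (ℕ.≤-trans m⁺≤b⁻ (ℕ.<⇒≤ b⁻<b))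

-- α j - j in the paper's 1-based indexing; the blocks A₁, …, A_t are its level sets.
offset : ∀ {k} → (Fin k → ℕ) → Fin k → ℤ
offset α j = α j ⊖ pos j

-≡-⇔⊖≡⊖ : ∀ a b c d → (+ a) ℤ.- (+ b) ≡ (+ c) ℤ.- (+ d) ⇔ a ⊖ b ≡ c ⊖ d
-≡-⇔⊖≡⊖ a b c d rewrite ℤ.[+m]-[+n]≡m⊖n a b | ℤ.[+m]-[+n]≡m⊖n c d = mk⇔ id id

InL⇔jump : ∀ {k} {α : Fin k → ℕ} {m m⁺ : Fin k} → toℕ m⁺ ≡ suc (toℕ m) →
           InL α m ⇔ suc (α m) < α m⁺
InL⇔jump {k} {α} {m} {m⁺} m⁺≡1+m = mk⇔
  (λ (p , jump) → subst₂ (λ x i → x < α i) (ℕ.+-comm (α m) 1) (next≡m⁺ p) jump)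
  (λ jump → 1+m<k , subst₂ (λ x i → x < α i) (ℕ.+-comm 1 (α m)) (sym (next≡m⁺ 1+m<k)) jump)
  where
  1+m<k : suc (toℕ m) < k
  1+m<k = subst (_< k) m⁺≡1+m (F.toℕ<n m⁺)
  next≡m⁺ : (p : suc (toℕ m) < k) → fromℕ< p ≡ m⁺
  next≡m⁺ p = F.toℕ-injective (trans (F.toℕ-fromℕ< p) (sym m⁺≡1+m))

offset-step : ∀ {k} {α : Fin k → ℕ} {m m⁺ : Fin k} → toℕ m⁺ ≡ suc (toℕ m) →
              offset α m ≡ suc (α m) ⊖ pos m⁺
offset-step {α = α} {m} m⁺≡1+m =
  trans (sym (ℤ.[1+m]⊖[1+n]≡m⊖n (α m) (pos m))) (cong (λ n → suc (α m) ⊖ suc n) (sym m⁺≡1+m))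

module _ {k} {α : Fin k → ℕ} (α↑ : StrictlyIncreasing α) where

  offset-step-≤ : ∀ {m m⁺ : Fin k} → toℕ m⁺ ≡ suc (toℕ m) → offset α m ℤ.≤ offset α m⁺
  offset-step-≤ {m} {m⁺} m⁺≡1+m rewrite offset-step {α = α} m⁺≡1+m =
    ℤ.⊖-monoˡ-≤ (pos m⁺) (α↑ m m⁺ (ℕ.≤-reflexive (sym m⁺≡1+m)))

  offset-step-< : ∀ {m m⁺ : Fin k} → toℕ m⁺ ≡ suc (toℕ m) → InL α m → offset α m ℤ.< offset α m⁺
  offset-step-< {m} {m⁺} m⁺≡1+m cut rewrite offset-step {α = α} m⁺≡1+m =
    ℤ.⊖-monoˡ-< (pos m⁺) (Equivalence.to (InL⇔jump {α = α} m⁺≡1+m) cut)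

  offset-step-≡ : ∀ {m m⁺ : Fin k} → toℕ m⁺ ≡ suc (toℕ m) → ¬ InL α m → offset α m ≡ offset α m⁺
  offset-step-≡ {m} {m⁺} m⁺≡1+m no-cut rewrite offset-step {α = α} m⁺≡1+m =
    cong (_⊖ pos m⁺) (ℕ.≤-antisym (α↑ m m⁺ (ℕ.≤-reflexive (sym m⁺≡1+m)))
                                  (ℕ.≮⇒≥ (no-cut ∘ Equivalence.from (InL⇔jump {α = α} m⁺≡1+m))))

  offset-mono : ∀ {i j : Fin k} → toℕ i ≤ toℕ j → offset α i ℤ.≤ offset α j
  offset-mono i≤j = Fin-chain (λ x y → offset α x ℤ.≤ offset α y) ℤ.≤-refl ℤ.≤-trans i≤j
    (λ _ m⁺≡1+m _ → offset-step-≤ m⁺≡1+m)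

  offset-<⇒< : ∀ {i j : Fin k} → offset α i ℤ.< offset α j → toℕ i < toℕ j
  offset-<⇒< offsetᵢ<offsetⱼ = ℕ.≰⇒> (λ j≤i → ℤ.<⇒≱ offsetᵢ<offsetⱼ (offset-mono j≤i))

  offset-jump : ∀ {ℓ a b : Fin k} → InL α ℓ → toℕ b ≤ toℕ ℓ → toℕ ℓ < toℕ a →
                offset α b ℤ.< offset α a
  offset-jump {ℓ} {a} {b} cut@(1+ℓ<k , _) b≤ℓ ℓ<a = begin-strict
    offset α b  ≤⟨ offset-mono b≤ℓ ⟩
    offset α ℓ  <⟨ offset-step-< ℓ⁺≡1+ℓ cut ⟩
    offset α ℓ⁺ ≤⟨ offset-mono (subst (_≤ toℕ a) (sym ℓ⁺≡1+ℓ) ℓ<a) ⟩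
    offset α a  ∎
    where
    open ℤ.≤-Reasoning
    ℓ⁺ : Fin k
    ℓ⁺ = fromℕ< 1+ℓ<k
    ℓ⁺≡1+ℓ : toℕ ℓ⁺ ≡ suc (toℕ ℓ)
    ℓ⁺≡1+ℓ = F.toℕ-fromℕ< 1+ℓ<k

  offset-flat : ∀ {a b : Fin k} → toℕ a ≤ toℕ b →
                (∀ ℓ → toℕ a ≤ toℕ ℓ → toℕ ℓ < toℕ b → ¬ InL α ℓ) → offset α a ≡ offset α b
  offset-flat a≤b no-cut = Fin-chain (λ x y → offset α x ≡ offset α y) refl trans a≤b
    (λ a≤m m⁺≡1+m m⁺≤b → offset-step-≡ m⁺≡1+m (no-cut _ a≤m (subst (_≤ _) m⁺≡1+m m⁺≤b)))

  offset-≡⇒SameBlock : ∀ {a b : Fin k} → offset α a ≡ offset α b → SameBlock α a b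
  offset-≡⇒SameBlock same-offset ℓ cut = mk⇔
    (s<s ∘ cut-below same-offset ∘ s<s⁻¹)
    (s<s ∘ cut-below (sym same-offset) ∘ s<s⁻¹)
    where
    cut-below : ∀ {a b : Fin k} → offset α a ≡ offset α b → toℕ ℓ < toℕ a → toℕ ℓ < toℕ b
    cut-below same-offset ℓ<a =
      ℕ.≰⇒> (λ b≤ℓ → ℤ.<-irrefl (sym same-offset) (offset-jump cut b≤ℓ ℓ<a))

  SameBlock⇒offset-≡ : ∀ {a b : Fin k} → SameBlock α a b → offset α a ≡ offset α b
  SameBlock⇒offset-≡ {a} {b} same with ℕ.≤-total (toℕ a) (toℕ b)
  ... | inj₁ a≤b = offset-flat a≤b λ ℓ a≤ℓ ℓ<b cut →
    ℕ.<⇒≱ (s<s⁻¹ (Equivalence.from (same ℓ cut) (s<s ℓ<b))) a≤ℓ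
  ... | inj₂ b≤a = sym (offset-flat b≤a λ ℓ b≤ℓ ℓ<a cut →
    ℕ.<⇒≱ (s<s⁻¹ (Equivalence.to (same ℓ cut) (s<s ℓ<a))) b≤ℓ)

module FromG₁ {k} {α : Fin k → ℕ} (α↑ : StrictlyIncreasing α) {γ : Fin k → ℕ} (σ : Permutation′ k)
              (γ-distinct : Distinct γ) (γ⪯α : γ ⪯ α)
              (γ-offset : ∀ j → γ j ⊖ pos (σ ⟨$⟩ʳ j) ≡ offset α j) where

  Matches : Fin k → Set
  Matches j = γ j ≡ α (σ ⟨$⟩ʳ j)

  matches⇒offset-≡ : ∀ {j} → Matches j → offset α (σ ⟨$⟩ʳ j) ≡ offset α j
  matches⇒offset-≡ {j} γⱼ≡ασⱼ = trans (cong (_⊖ pos (σ ⟨$⟩ʳ j)) (sym γⱼ≡ασⱼ)) (γ-offset j)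

  -- At a mismatch j whose image ρ = σ j is minimal, α ρ is the first value where the
  -- value sets of α and γ differ, which contradicts γ ⪯ α.
  module FirstMismatch {j} (ih : ∀ j' → toℕ (σ ⟨$⟩ʳ j') < toℕ (σ ⟨$⟩ʳ j) → Matches j')
                       (mismatch : ¬ Matches j) where
    ρ : Fin k
    ρ = σ ⟨$⟩ʳ j

    Lower : Pred (Fin k) _
    Lower i = offset α i ℤ.< offset α ρ

    Lower-σ⁻¹ : ∀ i → Lower i → Lower (σ ⟨$⟩ˡ i)
    Lower-σ⁻¹ i lower = begin-strict
      offset α (σ ⟨$⟩ˡ i)                ≡⟨ matches⇒offset-≡ (ih _ σσ⁻¹i<ρ) ⟨
      offset α (σ ⟨$⟩ʳ (σ ⟨$⟩ˡ i))       ≡⟨ cong (offset α) (Perm.inverseʳ σ) ⟩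
      offset α i                          <⟨ lower ⟩
      offset α ρ                          ∎
      where
      open ℤ.≤-Reasoning
      σσ⁻¹i<ρ : toℕ (σ ⟨$⟩ʳ (σ ⟨$⟩ˡ i)) < toℕ ρ
      σσ⁻¹i<ρ = subst (λ i′ → toℕ i′ < toℕ ρ) (sym (Perm.inverseʳ σ)) (offset-<⇒< α↑ lower)

    Lower⇒σ< : ∀ j' → Lower j' → toℕ (σ ⟨$⟩ʳ j') < toℕ ρ
    Lower⇒σ< j' =
      offset-<⇒< α↑ ∘ closed⇒closed-inverse σ (λ i → offset α i ℤ.<? offset α ρ) Lower-σ⁻¹ j'

    αρ∉γ : ¬ Any (_≡ α ρ) γ
    αρ∉γ (j' , γⱼ'≡αρ) with ℕ.<-cmp (toℕ (σ ⟨$⟩ʳ j')) (toℕ ρ)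
    ... | tri< σⱼ'<ρ _ _ = ℕ.<-irrefl (trans (sym (ih j' σⱼ'<ρ)) γⱼ'≡αρ) (α↑ _ _ σⱼ'<ρ)
    ... | tri≈ _ σⱼ'≡ρ _ = mismatch (subst Matches j'≡j (trans γⱼ'≡αρ (cong α (sym σj'≡ρ))))
      where
      σj'≡ρ : σ ⟨$⟩ʳ j' ≡ ρ
      σj'≡ρ = F.toℕ-injective σⱼ'≡ρ
      j'≡j : j' ≡ j
      j'≡j = trans (sym (Perm.inverseˡ σ)) (trans (cong (σ ⟨$⟩ˡ_) σj'≡ρ) (Perm.inverseˡ σ))
    ... | tri> _ _ ρ<σⱼ' = ℕ.<-asym ρ<σⱼ' (Lower⇒σ< j' (begin-strict
      offset α j'                 ≡⟨ γ-offset j' ⟨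
      γ j' ⊖ pos (σ ⟨$⟩ʳ j')      ≡⟨ cong (_⊖ pos (σ ⟨$⟩ʳ j')) γⱼ'≡αρ ⟩
      α ρ ⊖ pos (σ ⟨$⟩ʳ j')       <⟨ ℤ.⊖-monoʳ->-< (α ρ) (s<s ρ<σⱼ') ⟩
      offset α ρ                  ∎))
      where open ℤ.≤-Reasoning

    smaller-values-shared : ∀ j' → γ j' < α ρ → Any (_≡ γ j') α
    smaller-values-shared j' γⱼ'<αρ with toℕ (σ ⟨$⟩ʳ j') ℕ.<? toℕ ρ
    ... | yes σⱼ'<ρ = σ ⟨$⟩ʳ j' , sym (ih j' σⱼ'<ρ)
    ... | no σⱼ'≮ρ = ⊥-elim (σⱼ'≮ρ (Lower⇒σ< j' (begin-strict
      offset α j'              ≡⟨ γ-offset j' ⟨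
      γ j' ⊖ pos (σ ⟨$⟩ʳ j')   ≤⟨ ℤ.⊖-monoʳ-≥-≤ (γ j') (s≤s (ℕ.≮⇒≥ σⱼ'≮ρ)) ⟩
      γ j' ⊖ pos ρ             <⟨ ℤ.⊖-monoˡ-< (pos ρ) γⱼ'<αρ ⟩
      offset α ρ               ∎)))
      where open ℤ.≤-Reasoning

    lex-witness : LexBelowAt α γ (α ρ)
    lex-witness = record
      { value     = ρ , refl
      ; not-value = αρ∉γ
      ; below     = smaller-values-shared
      }

  matches-below : ∀ r j → toℕ (σ ⟨$⟩ʳ j) < r → Matches j
  matches-below (suc r) j σⱼ<1+r with ℕ.m≤n⇒m<n∨m≡n (s≤s⁻¹ σⱼ<1+r)
  ... | inj₁ σⱼ<r = matches-below r j σⱼ<r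
  ... | inj₂ σⱼ≡r with γ j ℕ.≟ α (σ ⟨$⟩ʳ j)
  ...   | yes γⱼ≡ασⱼ = γⱼ≡ασⱼ
  ...   | no mismatch =
    ⊥-elim (⪯⇒¬LexBelowAt γ-distinct γ⪯α (FirstMismatch.lex-witness ih mismatch))
    where
    ih : ∀ j' → toℕ (σ ⟨$⟩ʳ j') < toℕ (σ ⟨$⟩ʳ j) → Matches j'
    ih j' σⱼ'<σⱼ = matches-below r j' (subst (toℕ (σ ⟨$⟩ʳ j') <_) σⱼ≡r σⱼ'<σⱼ)

  matches : ∀ j → Matches j
  matches j = matches-below k j (F.toℕ<n (σ ⟨$⟩ʳ j))

  σ∈T : InT α σ
  σ∈T j = offset-≡⇒SameBlock α↑ (sym (matches⇒offset-≡ (matches j)))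

proposition4p3 : (k : ℕ) → k ≥ 1 → (α : Fin k → ℕ) → StrictlyIncreasing α →
    (γ : Fin k → ℕ) (σ : Permutation′ k) → G₁ α γ σ ⇔ G₂ α γ σ
proposition4p3 _ _ α α↑ γ σ = mk⇔ G₁⇒G₂ G₂⇒G₁
  where
  G₁⇒G₂ : G₁ α γ σ → G₂ α γ σ
  G₁⇒G₂ (γ-distinct , γ⪯α , eqs) = γ-distinct , σ∈T , matches
    where
    γ-offset : ∀ j → γ j ⊖ pos (σ ⟨$⟩ʳ j) ≡ offset α j
    γ-offset j = Equivalence.to (-≡-⇔⊖≡⊖ (γ j) (pos (σ ⟨$⟩ʳ j)) (α j) (pos j)) (eqs j)
    open FromG₁ α↑ σ γ-distinct γ⪯α γ-offset using (σ∈T; matches)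

  G₂⇒G₁ : G₂ α γ σ → G₁ α γ σ
  G₂⇒G₁ (γ-distinct , σ∈T , γ≡α∘σ) = γ-distinct , ℚ.≤-reflexive sums≡ , eqs
    where
    sums≡ : sumℚ (λ i → twoInv (α i)) ≡ sumℚ (λ i → twoInv (γ i))
    sums≡ = sumℚ-permute σ (λ i → cong twoInv (sym (γ≡α∘σ i)))
    γ-offset : ∀ j → γ j ⊖ pos (σ ⟨$⟩ʳ j) ≡ offset α j
    γ-offset j = trans (cong (_⊖ pos (σ ⟨$⟩ʳ j)) (γ≡α∘σ j)) (sym (SameBlock⇒offset-≡ α↑ (σ∈T j)))
    eqs : ∀ j → (+ γ j) ℤ.- (+ pos (σ ⟨$⟩ʳ j)) ≡ (+ α j) ℤ.- (+ pos j)
    eqs j = Equivalence.from (-≡-⇔⊖≡⊖ (γ j) (pos (σ ⟨$⟩ʳ j)) (α j) (pos j)) (γ-offset j)
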